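{- Let $n\ge1$ and let $G$ be the sibling tree $ST_n$. Then every minimum dominating set of $G$ contains at least $2^{n-1}$ vertices from levels $n-1$ and $n$.
   Context: The sibling tree $ST_n$ has vertex set $\{1,\dots,2^{n+1}-1\}$; its edges are the complete binary tree edges $\{x,2x\},\{x,2x+1\}$ for $1\le x\le 2^n-1$ together with the sibling edges $\{2x,2x+1\}$ for $1\le x\le 2^n-1$. The root $1$ is at level $0$ and vertex $v$ is at level $i$ iff $2^i\le v\le 2^{i+1}-1$. A dominating set is a set $S$ such that every vertex outside $S$ has a neighbor in $S$; a minimum dominating set is one of least cardinality. -}

module Defs where

open import Data.Nat using (ℕ; zero; suc; _+_; _*_; _∸_; _^_; _≤_)
open import Data.Nat.Properties using (_≤?_)
open import Data.Fin using (Fin; toℕ)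
open import Data.Fin.Subset using (Subset; _∈_; _∉_; _∩_; ∣_∣)
open import Data.Vec using (tabulate)
open import Data.Bool using (Bool)
open import Relation.Nullary.Decidable using (does)
open import Data.Product using (Σ; _×_)
open import Data.Sum using (_⊎_)
open import Relation.Binary.PropositionalEquality using (_≡_)

size : ℕ → ℕ
size n = 2 ^ suc n ∸ 1

-- Vertex i : Fin (size n) stands for the label toℕ i + 1 ∈ {1,…,2^(n+1)-1}.
label : {m : ℕ} → Fin m → ℕ
label i = suc (toℕ i)

-- Edge relation of ST_n on labels (both endpoints are assumed in range).
-- Tree edges {x,2x}, {x,2x+1}; sibling edges {2x,2x+1} with x ≥ 1.
-- (The bound x ≤ 2^n - 1 is automatic once 2x, 2x+1 are vertices.)
TreeEdge : ℕ → ℕ → Set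
TreeEdge x y = (y ≡ 2 * x) ⊎ (y ≡ 2 * x + 1)

SiblingEdge : ℕ → ℕ → Set
SiblingEdge a b = Σ ℕ λ x → (1 ≤ x) × (a ≡ 2 * x) × (b ≡ 2 * x + 1)

Edge : ℕ → ℕ → Set
Edge a b = TreeEdge a b ⊎ TreeEdge b a ⊎ SiblingEdge a b ⊎ SiblingEdge b a

Adj : (n : ℕ) → Fin (size n) → Fin (size n) → Set
Adj n u v = Edge (label u) (label v)

Dominating : (n : ℕ) → Subset (size n) → Set
Dominating n S = ∀ v → v ∉ S → Σ (Fin (size n)) λ u → (u ∈ S) × Adj n u v

MinDominating : (n : ℕ) → Subset (size n) → Set
MinDominating n S = Dominating n S × (∀ T → Dominating n T → ∣ S ∣ ≤ ∣ T ∣)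

LastTwoLevels : (n : ℕ) → Subset (size n)
LastTwoLevels n = tabulate λ i → does (2 ^ (n ∸ 1) ≤? label i)

module Submission where

-- Let n = k + 1 and N = 2^k, so level n-1 consists of the labels
-- x with N ≤ x < 2N and level n of the leaves.  For such an x the leaf 2x has
-- closed neighbourhood {x, 2x, 2x+1} (a leaf has no children and its only
-- sibling is 2x+1), so any dominating set S contains a vertex of the
-- "family" {x, 2x, 2x+1}; all its members lie on levels n-1 and n.  The N
-- families of the level-(n-1) vertices are pairwise disjoint, hence choosing
-- one such vertex for each x is an injection into S ∩ LastTwoLevels n, which
-- therefore has at least N = 2^(n-1) elements.

open import Defs
open import Data.Nat using (ℕ; _≤_; _^_; _∸_)
open import Data.Fin.Subset using (Subset; _∩_; ∣_∣)

open import Data.Nat using (zero; suc; _+_; _*_; _<_; z≤n; s≤s; ⌊_/2⌋)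
open import Data.Nat.Properties
open import Data.Fin using (Fin; toℕ; fromℕ<)
import Data.Fin.Properties as Fin
open import Data.Fin.Subset using (_∈_; _-_)
open import Data.Fin.Subset.Properties
  using (_∈?_; x∈p∩q⁺; x∈p⇒∣p-x∣<∣p∣; x∈p∧x∉q⇒x∈p─q; x∈⁅y⁆⇒x≡y)
open import Data.Vec.Properties using (lookup∘tabulate; lookup⇒[]=)
open import Data.Product using (Σ; _×_; _,_; proj₁; proj₂)
open import Data.Sum using (_⊎_; inj₁; inj₂)
open import Data.Empty using (⊥-elim)
open import Function using (_∘_; Injective)
open import Relation.Nullary using (yes; no)
open import Relation.Nullary.Decidable using (dec-true)
open import Relation.Binary.PropositionalEquality
  using (_≡_; refl; sym; trans; cong; subst)

injection⇒≤∣∣ : ∀ {k m} (P : Subset m) (f : Fin k → Fin m) →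
  (∀ j → f j ∈ P) → Injective _≡_ _≡_ f → k ≤ ∣ P ∣
injection⇒≤∣∣ {zero}  P f f∈P f-inj = z≤n
injection⇒≤∣∣ {suc k} P f f∈P f-inj =
  ≤-trans (s≤s rest) (x∈p⇒∣p-x∣<∣p∣ (f∈P Fin.zero))
  where
  rest : k ≤ ∣ P - f Fin.zero ∣
  rest = injection⇒≤∣∣ (P - f Fin.zero) (f ∘ Fin.suc)
    (λ j → x∈p∧x∉q⇒x∈p─q (f∈P (Fin.suc j))
      (λ f[j]∈⁅f0⁆ → Fin.0≢1+n (f-inj (sym (x∈⁅y⁆⇒x≡y _ f[j]∈⁅f0⁆)))))
    (Fin.suc-injective ∘ f-inj)

Family : ℕ → ℕ → Set
Family x a = (a ≡ x) ⊎ (a ≡ 2 * x) ⊎ (a ≡ 2 * x + 1)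

family-≥ : ∀ {x a} → Family x a → x ≤ a
family-≥ {x} (inj₁ refl)         = ≤-refl
family-≥ {x} (inj₂ (inj₁ refl))  = m≤n*m x 2
family-≥ {x} (inj₂ (inj₂ refl))  = ≤-trans (m≤n*m x 2) (m≤m+n (2 * x) 1)

⌊2x/2⌋≡x : ∀ x → ⌊ 2 * x /2⌋ ≡ x
⌊2x/2⌋≡x zero = refl
⌊2x/2⌋≡x (suc x) = trans (cong ⌊_/2⌋ (*-suc 2 x)) (cong suc (⌊2x/2⌋≡x x))

⌊2x+1/2⌋≡x : ∀ x → ⌊ 2 * x + 1 /2⌋ ≡ x
⌊2x+1/2⌋≡x zero = refl
⌊2x+1/2⌋≡x (suc x) =
  trans (cong (λ y → ⌊ y + 1 /2⌋) (*-suc 2 x)) (cong suc (⌊2x+1/2⌋≡x x))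

owner : ℕ → ℕ → ℕ
owner N a with a <? 2 * N
... | yes _ = a
... | no  _ = ⌊ a /2⌋

family-owner : ∀ {N x a} → N ≤ x → x < 2 * N → Family x a → x ≡ owner N a
family-owner {N} {x} {a} N≤x x<2N fam with a <? 2 * N | fam
... | yes _    | inj₁ refl         = refl
... | yes a<2N | inj₂ (inj₁ refl)  = ⊥-elim (<⇒≱ a<2N (*-monoʳ-≤ 2 N≤x))
... | yes a<2N | inj₂ (inj₂ refl)  =
  ⊥-elim (<⇒≱ a<2N (≤-trans (*-monoʳ-≤ 2 N≤x) (m≤m+n (2 * x) 1)))
... | no a≮2N  | inj₁ refl         = ⊥-elim (a≮2N x<2N)
... | no _     | inj₂ (inj₁ refl)  = sym (⌊2x/2⌋≡x x)
... | no _     | inj₂ (inj₂ refl)  = sym (⌊2x+1/2⌋≡x x)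

families-disjoint : ∀ {N x y a} → N ≤ x → x < 2 * N → N ≤ y → y < 2 * N →
  Family x a → Family y a → x ≡ y
families-disjoint N≤x x<2N N≤y y<2N fx fy =
  trans (family-owner N≤x x<2N fx) (sym (family-owner N≤y y<2N fy))

-- A leaf 2x (its children 4x, 4x+1 are not below the label bound M) has only
-- its parent x and its sibling 2x+1 as neighbours.
leaf-neighbour : ∀ {M a x} → a < M → M ≤ 2 * (2 * x) → Edge a (2 * x) →
  Family x a
leaf-neighbour {a = a} {x} _ _ (inj₁ (inj₁ 2x≡2a)) =
  inj₁ (*-cancelˡ-≡ a x 2 (sym 2x≡2a))
leaf-neighbour {a = a} {x} _ _ (inj₁ (inj₂ 2x≡2a+1)) =
  ⊥-elim (even≢odd x a (trans 2x≡2a+1 (+-comm (2 * a) 1)))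
leaf-neighbour a<M M≤4x (inj₂ (inj₁ (inj₁ a≡4x))) =
  ⊥-elim (<⇒≱ a<M (≤-trans M≤4x (≤-reflexive (sym a≡4x))))
leaf-neighbour {x = x} a<M M≤4x (inj₂ (inj₁ (inj₂ a≡4x+1))) =
  ⊥-elim (<⇒≱ a<M (≤-trans M≤4x (≤-trans (m≤m+n (2 * (2 * x)) 1)
    (≤-reflexive (sym a≡4x+1)))))
leaf-neighbour {x = x} _ _ (inj₂ (inj₂ (inj₁ (y , _ , _ , 2x≡2y+1)))) =
  ⊥-elim (even≢odd x y (trans 2x≡2y+1 (+-comm (2 * y) 1)))
leaf-neighbour {x = x} _ _ (inj₂ (inj₂ (inj₂ (y , _ , 2x≡2y , a≡2y+1)))) =
  inj₂ (inj₂ (trans a≡2y+1 (cong (λ z → 2 * z + 1) (sym (*-cancelˡ-≡ x y 2 2x≡2y)))))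

label< : ∀ n (v : Fin (size n)) → label v < 2 ^ suc n
label< n v = 1+m<n (Fin.toℕ<n v)
  where
  1+m<n : ∀ {m M} → m < M ∸ 1 → suc m < M
  1+m<n {M = suc M} m<M = s≤s m<M

vertex-labelled : ∀ n ℓ → 1 ≤ ℓ → ℓ < 2 ^ suc n →
  Σ (Fin (size n)) λ v → label v ≡ ℓ
vertex-labelled n (suc m) _ 1+m<M = fromℕ< (m<M∸1 1+m<M) , cong suc (Fin.toℕ-fromℕ< _)
  where
  m<M∸1 : ∀ {M} → suc m < M → m < M ∸ 1
  m<M∸1 {suc M} (s≤s m<M) = m<M

-- Every dominating set of ST_n meets the family of x whenever 2x is a vertex
-- of ST_n and a leaf: either 2x itself is chosen, or its dominator is.
dominator-in-family : ∀ n (S : Subset (size n)) → Dominating n S →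
  ∀ x → 2 * x < 2 ^ suc n → 2 ^ suc n ≤ 2 * (2 * x) →
  Σ (Fin (size n)) λ u → u ∈ S × Family x (label u)
dominator-in-family n S dom zero 0<M M≤0 = ⊥-elim (<⇒≱ 0<M M≤0)
dominator-in-family n S dom x@(suc _) 2x<M M≤4x
  with vertex-labelled n (2 * x) (s≤s z≤n) 2x<M
... | leaf , leaf≡2x with leaf ∈? S
...   | yes leaf∈S = leaf , leaf∈S , inj₂ (inj₁ leaf≡2x)
...   | no  leaf∉S with dom leaf leaf∉S
...     | u , u∈S , u~leaf =
  u , u∈S , leaf-neighbour (label< n u) M≤4x (subst (Edge (label u)) leaf≡2x u~leaf)

∈LastTwoLevels : ∀ n (u : Fin (size n)) → 2 ^ (n ∸ 1) ≤ label u →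
  u ∈ LastTwoLevels n
∈LastTwoLevels n u bound =
  lookup⇒[]= u (LastTwoLevels n)
    (trans (lookup∘tabulate _ u) (dec-true (2 ^ (n ∸ 1) ≤? label u) bound))

lemma9 : (n : ℕ) → 1 ≤ n → (S : Subset (size n)) → MinDominating n S →
    2 ^ (n ∸ 1) ≤ ∣ S ∩ LastTwoLevels n ∣
lemma9 (suc k) _ S (dom , _) =
  injection⇒≤∣∣ (S ∩ LastTwoLevels (suc k)) chosen chosen∈ chosen-injective
  where
  N = 2 ^ k
  x : Fin N → ℕ
  x j = N + toℕ j
  N≤x : ∀ j → N ≤ x j
  N≤x j = m≤m+n N (toℕ j)
  x<2N : ∀ j → x j < 2 * N
  x<2N j = subst (N + toℕ j <_) (cong (N +_) (sym (+-identityʳ N)))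
    (+-monoʳ-< N (Fin.toℕ<n j))
  pick : ∀ j → Σ (Fin (size (suc k))) λ u → u ∈ S × Family (x j) (label u)
  pick j = dominator-in-family (suc k) S dom (x j)
    (*-monoʳ-< 2 (x<2N j)) (*-monoʳ-≤ 2 (*-monoʳ-≤ 2 (N≤x j)))
  chosen : Fin N → Fin (size (suc k))
  chosen = proj₁ ∘ pick
  family : ∀ j → Family (x j) (label (chosen j))
  family j = proj₂ (proj₂ (pick j))
  chosen∈ : ∀ j → chosen j ∈ S ∩ LastTwoLevels (suc k)
  chosen∈ j = x∈p∩q⁺ (proj₁ (proj₂ (pick j)) ,
    ∈LastTwoLevels (suc k) (chosen j) (≤-trans (N≤x j) (family-≥ (family j))))
  -- Distinct band vertices have disjoint families, so the choice is injective.
  chosen-injective : Injective _≡_ _≡_ chosen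
  chosen-injective {i} {j} same = Fin.toℕ-injective (+-cancelˡ-≡ N _ _
    (families-disjoint (N≤x i) (x<2N i) (N≤x j) (x<2N j) (family i)
      (subst (Family (x j) ∘ label) (sym same) (family j))))
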